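{- Let $r\ge2$ and $1\le i\le r$. Let $x_\lambda=x_{n_{1,1}}\,(x_{n_{2,1}}\cdots x_{n_{2,f(2)}})\cdots(x_{n_{r-1,1}}\cdots x_{n_{r-1,f(r-1)}})\,(x_{n_{r,1}}\cdots x_{n_{r,\ell}})$ with $0\leq\ell<f(r)$, where the indices are positive integers with $n_{1,1}\le n_{2,1}\le\dots\le n_{r-1,f(r-1)}\le n_{r,1}\le\dots\le n_{r,\ell}$, $f(1)=1$, $f(j)=n_{j-1,f(j-1)}$ for $2\le j\le i$, and $f(j)=n_{j-1,f(j-1)}-1$ for $i+1\le j\le r$; let $\lambda$ be the partition whose parts are these indices. Then $\lambda\in\mathcal{D}_{r,i}$, and in its $(r-i)$-Durfee dissection $\lambda$ has exactly $r-i$ horizontal Durfee rectangles of height $>0$ followed by exactly $i-1$ non-empty Durfee squares; i.e. $c_1,\dots,c_{r-1}\geq1$ and $\mu^{(r-1)}$ is empty.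
   Context: To a partition $\lambda=(\lambda_1,\dots,\lambda_s)$ is associated the monomial $x_\lambda=x_{\lambda_1}\cdots x_{\lambda_s}$. For a (possibly empty) partition $\mu=(\mu_1,\dots,\mu_t)$ let $\mathrm{sq}(\mu)=\max\{d\ge0:d\le t,\ \mu_d\ge d\}$ (side of the Durfee square) and $\mathrm{rect}(\mu)=\max\{h\ge0:h\le t,\ \mu_h\ge h+1\}$ (height of the horizontal Durfee rectangle with $h$ rows and $h+1$ columns). The $(r-i)$-Durfee dissection of $\lambda$: $\mu^{(0)}=\lambda$, $c_j=\mathrm{rect}(\mu^{(j-1)})$ for $1\le j\le r-i$, $c_j=\mathrm{sq}(\mu^{(j-1)})$ for $j>r-i$, and $\mu^{(j)}$ is $\mu^{(j-1)}$ with its first $c_j$ parts deleted. $\mathcal{D}_{r,i}$ is the set of partitions for which $\mu^{(r-1)}$ is empty. -}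

module Defs where

open import Data.Nat using (ℕ; zero; suc; _∸_; _≤ᵇ_; _≤_)
open import Data.Bool using (Bool; if_then_else_)
open import Data.List using (List; []; _∷_; map; upTo; concatMap; _++_; length; drop; reverse)
open import Data.List.Relation.Unary.Linked using (Linked)
open import Data.List.Relation.Unary.All using (All)

idx : ℕ → List ℕ
idx k = map suc (upTo k)

-- 1-indexed access μ_d of a list; 0 when out of range (never used out of range)
part : List ℕ → ℕ → ℕ
part []       _             = 0
part (x ∷ xs) zero          = 0
part (x ∷ xs) (suc zero)    = x
part (x ∷ xs) (suc (suc k)) = part xs (suc k)

largest : (ℕ → Bool) → ℕ → ℕ
largest P zero    = 0
largest P (suc t) = if P (suc t) then suc t else largest P t

-- partitions are lists of parts in weakly decreasing order
-- sq(μ) = max{d ≥ 0 : d ≤ t, μ_d ≥ d}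
sq : List ℕ → ℕ
sq μ = largest (λ d → d ≤ᵇ part μ d) (length μ)

rect : List ℕ → ℕ
rect μ = largest (λ h → suc h ≤ᵇ part μ h) (length μ)

cAt : ℕ → ℕ → ℕ → List ℕ → ℕ
cAt r i j μ = if j ≤ᵇ (r ∸ i) then rect μ else sq μ

durfeeμ : ℕ → ℕ → List ℕ → ℕ → List ℕ
durfeeμ r i λ' zero    = λ'
durfeeμ r i λ' (suc j) = drop (cAt r i (suc j) (durfeeμ r i λ' j)) (durfeeμ r i λ' j)

durfeeC : ℕ → ℕ → List ℕ → ℕ → ℕ
durfeeC r i λ' j = cAt r i j (durfeeμ r i λ' (j ∸ 1))

InD : ℕ → ℕ → List ℕ → Set
InD r i λ' = durfeeμ r i λ' (r ∸ 1) ≡ []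
  where open import Relation.Binary.PropositionalEquality using (_≡_)

-- the sequence of indices n_{1,1}, …, n_{1,f(1)}, n_{2,1}, …, n_{r-1,f(r-1)}, n_{r,1}, …, n_{r,ℓ}
-- in the order they appear in x_λ (weakly increasing by hypothesis)
indexSeq : ℕ → (ℕ → ℕ → ℕ) → (ℕ → ℕ) → ℕ → List ℕ
indexSeq r n f ℓ = concatMap (λ j → map (n j) (idx (f j))) (idx (r ∸ 1)) ++ map (n r) (idx ℓ)

partitionOf : ℕ → (ℕ → ℕ → ℕ) → (ℕ → ℕ) → ℕ → List ℕ
partitionOf r n f ℓ = reverse (indexSeq r n f ℓ)

-- Split the index sequence into blocks, block j being n_{j,1}, …, n_{j,f(j)}.  Each remainder
-- μ^(j) of the dissection is the reversal of an initial segment containing blocks 1, …, κ+1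
-- completely but fewer than f(κ+2) indices of block κ+2 (κ = r−2−j).  Since f(κ+2) is
-- n_{κ+1,f(κ+1)} (minus one for rectangles), the next Durfee square (rectangle) of μ reaches
-- the part n_{κ+1,f(κ+1)}: it is non-empty and cuts into block κ+1.  It stops before block κ,
-- whose indices are at most n_{κ,f(κ)} ≤ f(κ+1) (+1) while at least f(κ+1) parts precede them.
-- After r−1 steps the segment is shorter than block 1, a single index, hence empty.
module Submission where

open import Defs
open import Data.Nat using (ℕ; zero; suc; _+_; _∸_; _⊓_; _≤_; _<_; _≤ᵇ_; z≤n; s≤s; _≤?_; _<?_)
open import Data.Nat.Properties
open import Data.Bool using (true; false; T)
open import Data.Empty using (⊥-elim)
open import Data.Sum using (inj₁; inj₂)
open import Data.Product using (_×_; _,_; proj₁; proj₂; ∃-syntax)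
open import Data.List using (List; []; _∷_; map; upTo; concatMap; _++_; length; drop; take; reverse; [_])
open import Data.List.Properties
  using (length-++; length-map; length-applyUpTo; length-reverse; length-take; length-drop; ++-assoc; map-++;
         concatMap-++; applyUpTo-∷ʳ; reverse-++; take++drop≡id; take-take; take-all; ++-identityʳ;
         unfold-reverse)
open import Data.List.Relation.Unary.Linked using (Linked; []; [-]; _∷_)
open import Data.List.Relation.Unary.All using (All)
open import Relation.Binary.PropositionalEquality
  using (_≡_; refl; sym; trans; cong; cong₂; subst; module ≡-Reasoning)
open import Relation.Nullary using (¬_; yes; no)

part-zero : ∀ xs → part xs 0 ≡ 0
part-zero []      = refl
part-zero (_ ∷ _) = refl

part-beyond : ∀ xs {p} → length xs < p → part xs p ≡ 0
part-beyond []       _                         = refl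
part-beyond (x ∷ xs) {suc zero}    (s≤s ())
part-beyond (x ∷ xs) {suc (suc p)} (s≤s len<p) = part-beyond xs len<p

part-++ˡ : ∀ xs ys {p} → p ≤ length xs → part (xs ++ ys) p ≡ part xs p
part-++ˡ []       ys z≤n              = part-zero ys
part-++ˡ (x ∷ xs) ys {zero}        _  = refl
part-++ˡ (x ∷ xs) ys {suc zero}    _  = refl
part-++ˡ (x ∷ xs) ys {suc (suc p)} (s≤s p≤len) = part-++ˡ xs ys p≤len

part-++ʳ : ∀ xs ys p → part (xs ++ ys) (suc (length xs + p)) ≡ part ys (suc p)
part-++ʳ []       ys p = refl
part-++ʳ (x ∷ xs) ys p = part-++ʳ xs ys p

part-take : ∀ m xs {p} → p ≤ m → part (take m xs) p ≡ part xs p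
part-take m       xs       {zero}        _           = trans (part-zero (take m xs)) (sym (part-zero xs))
part-take (suc m) []       {suc p}       _           = refl
part-take (suc m) (x ∷ xs) {suc zero}    _           = refl
part-take (suc m) (x ∷ xs) {suc (suc p)} (s≤s p<m)   = part-take m xs p<m

part-reverse : ∀ xs p q → p + q ≡ suc (length xs) → part (reverse xs) p ≡ part xs q
part-reverse [] p q _ = refl
part-reverse (x ∷ xs) p q p+q≡ rewrite unfold-reverse x xs with q
... | zero = part-beyond (reverse xs ++ [ x ]) (subst (_< p) (sym len) (≤-reflexive (sym p≡)))
  where
    p≡ : p ≡ suc (suc (length xs))
    p≡ = trans (sym (+-identityʳ p)) p+q≡
    len : length (reverse xs ++ [ x ]) ≡ suc (length xs)
    len = trans (length-++ (reverse xs)) (trans (+-comm _ 1) (cong suc (length-reverse xs)))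
... | suc zero = trans (cong (part (reverse xs ++ [ x ])) p≡) (part-++ʳ (reverse xs) [ x ] 0)
  where
    p≡ : p ≡ suc (length (reverse xs) + 0)
    p≡ = trans (suc-injective (trans (+-comm 1 p) p+q≡))
               (cong suc (trans (sym (length-reverse xs)) (sym (+-identityʳ _))))
... | suc (suc q) = trans (part-++ˡ (reverse xs) [ x ] p≤len) (part-reverse xs p (suc q) p+q≡′)
  where
    p+q≡′ : p + suc q ≡ suc (length xs)
    p+q≡′ = suc-injective (trans (sym (+-suc p (suc q))) p+q≡)
    p≤len : p ≤ length (reverse xs)
    p≤len = subst (p ≤_) (sym (length-reverse xs))
                  (subst (p ≤_) (suc-injective (trans (sym (+-suc p q)) p+q≡′)) (m≤m+n p q))

length-take-≤ : ∀ m (xs : List ℕ) → m ≤ length xs → length (take m xs) ≡ m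
length-take-≤ m xs m≤len = trans (length-take m xs) (m≤n⇒m⊓n≡m m≤len)

part-reverse-take : ∀ xs m {h q} → m ≤ length xs → q ≤ m → h + q ≡ suc m →
                    part (reverse (take m xs)) h ≡ part xs q
part-reverse-take xs m {h} {q} m≤len q≤m h+q≡ =
  trans (part-reverse (take m xs) h q (trans h+q≡ (cong suc (sym (length-take-≤ m xs m≤len)))))
        (part-take m xs q≤m)

drop-length-++ : ∀ (xs ys : List ℕ) → drop (length xs) (xs ++ ys) ≡ ys
drop-length-++ []       ys = refl
drop-length-++ (x ∷ xs) ys = drop-length-++ xs ys

drop-reverse : ∀ (xs : List ℕ) c → c ≤ length xs → drop c (reverse xs) ≡ reverse (take (length xs ∸ c) xs)
drop-reverse xs c c≤len = begin
    drop c (reverse xs)                                 ≡⟨ cong (λ ys → drop c (reverse ys)) (sym (take++drop≡id a xs)) ⟩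
    drop c (reverse (take a xs ++ drop a xs))           ≡⟨ cong (drop c) (reverse-++ (take a xs) (drop a xs)) ⟩
    drop c (reverse (drop a xs) ++ reverse (take a xs)) ≡⟨ cong (λ k → drop k (reverse (drop a xs) ++ reverse (take a xs))) (sym len) ⟩
    drop (length (reverse (drop a xs))) (reverse (drop a xs) ++ reverse (take a xs))
                                                        ≡⟨ drop-length-++ (reverse (drop a xs)) (reverse (take a xs)) ⟩
    reverse (take a xs)                                 ∎
  where
    open ≡-Reasoning
    a = length xs ∸ c
    len : length (reverse (drop a xs)) ≡ c
    len = trans (length-reverse (drop a xs))
                (trans (length-drop a xs) (m∸[m∸n]≡n c≤len))

drop-reverse-take : ∀ xs m c → m ≤ length xs → c ≤ m →
                    drop c (reverse (take m xs)) ≡ reverse (take (m ∸ c) xs)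
drop-reverse-take xs m c m≤len c≤m = begin
    drop c (reverse (take m xs))                             ≡⟨ drop-reverse (take m xs) c (subst (c ≤_) (sym len) c≤m) ⟩
    reverse (take (length (take m xs) ∸ c) (take m xs))     ≡⟨ cong (λ k → reverse (take (k ∸ c) (take m xs))) len ⟩
    reverse (take (m ∸ c) (take m xs))                      ≡⟨ cong reverse (take-take (m ∸ c) m xs) ⟩
    reverse (take ((m ∸ c) ⊓ m) xs)                         ≡⟨ cong (λ k → reverse (take k xs)) (m≤n⇒m⊓n≡m (m∸n≤m m c)) ⟩
    reverse (take (m ∸ c) xs)                               ∎
  where
    open ≡-Reasoning
    len : length (take m xs) ≡ m
    len = length-take-≤ m xs m≤len

part-mono : ∀ {xs} → Linked _≤_ xs → ∀ {p q} → p ≤ q → q ≤ length xs → part xs p ≤ part xs q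
part-mono {xs} _ {zero} {q} _ _ = subst (_≤ part xs q) (sym (part-zero xs)) z≤n
part-mono [] {suc p} () z≤n
part-mono [-] {suc zero} {suc zero} _ _ = ≤-refl
part-mono [-] {suc _} {suc (suc _)} _ (s≤s ())
part-mono [-] {suc (suc _)} {suc zero} (s≤s ()) _
part-mono (x≤y ∷ sorted) {suc zero}    {suc zero}    _ _ = ≤-refl
part-mono (x≤y ∷ sorted) {suc zero}    {suc (suc q)} _ (s≤s q≤len) =
  ≤-trans x≤y (part-mono sorted {suc zero} {suc q} (s≤s z≤n) q≤len)
part-mono (x≤y ∷ sorted) {suc (suc p)} {suc (suc q)} (s≤s p≤q) (s≤s q≤len) = part-mono sorted p≤q q≤len

≤-largest : ∀ P t {d} → T (P d) → d ≤ t → d ≤ largest P t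
≤-largest P t       {zero}  _  _ = z≤n
≤-largest P (suc t) {suc d} Pd d≤t with P (suc t) in eq
... | true  = d≤t
... | false with m≤n⇒m<n∨m≡n d≤t
...   | inj₁ d<t  = ≤-largest P t Pd (≤-pred d<t)
...   | inj₂ refl = ⊥-elim (subst T eq Pd)

largest-≤ : ∀ P t b → (∀ h → b < h → h ≤ t → ¬ T (P h)) → largest P t ≤ b
largest-≤ P zero    b _ = z≤n
largest-≤ P (suc t) b none with P (suc t) in eq
... | true with b <? suc t
...   | yes b<t = ⊥-elim (none (suc t) b<t ≤-refl (subst T (sym eq) _))
...   | no  b≮t = ≮⇒≥ b≮t
largest-≤ P (suc t) b none | false = largest-≤ P t b (λ h b<h h≤t → none h b<h (m≤n⇒m≤1+n h≤t))

-- rect μ and sq μ are, definitionally, durfee 1 μ and durfee 0 μ.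
durfee : ℕ → List ℕ → ℕ
durfee o μ = largest (λ h → o + h ≤ᵇ part μ h) (length μ)

≤-durfee : ∀ o μ {d} → d ≤ length μ → o + d ≤ part μ d → d ≤ durfee o μ
≤-durfee o μ d≤len le = ≤-largest _ (length μ) (≤⇒≤ᵇ le) d≤len

durfee-≤ : ∀ o μ b → (∀ h → b < h → h ≤ length μ → part μ h < o + h) → durfee o μ ≤ b
durfee-≤ o μ b small = largest-≤ _ (length μ) b
  (λ h b<h h≤len le → <⇒≱ (small h b<h h≤len) (≤ᵇ⇒≤ (o + h) (part μ h) le))

≤-durfee-reverse-take : ∀ o xs m a → m ≤ length xs → 1 ≤ a → a ≤ m →
                        o + suc (m ∸ a) ≤ part xs a → suc (m ∸ a) ≤ durfee o (reverse (take m xs))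
≤-durfee-reverse-take o xs m a m≤len 1≤a a≤m big =
  ≤-durfee o (reverse (take m xs)) d≤len (subst (o + suc (m ∸ a) ≤_) (sym part≡) big)
  where
    part≡ : part (reverse (take m xs)) (suc (m ∸ a)) ≡ part xs a
    part≡ = part-reverse-take xs m m≤len a≤m (cong suc (m∸n+n≡m a≤m))
    d≤len : suc (m ∸ a) ≤ length (reverse (take m xs))
    d≤len = subst (suc (m ∸ a) ≤_) (sym (trans (length-reverse (take m xs)) (length-take-≤ m xs m≤len)))
                  (∸-monoʳ-< 1≤a a≤m)

durfee-reverse-take-≤ : ∀ o xs m s → m ≤ length xs → s ≤ m →
                        (∀ q → 1 ≤ q → q ≤ s → part xs q ≤ o + (m ∸ s)) →
                        durfee o (reverse (take m xs)) ≤ m ∸ s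
durfee-reverse-take-≤ o xs m s m≤len s≤m small = durfee-≤ o (reverse (take m xs)) (m ∸ s) bound
  where
    bound : ∀ h → m ∸ s < h → h ≤ length (reverse (take m xs)) → part (reverse (take m xs)) h < o + h
    bound h m∸s<h h≤len = subst (_< o + h) (sym part≡) (≤-<-trans (small q 1≤q q≤s) (+-monoʳ-< o m∸s<h))
      where
        h≤m : h ≤ m
        h≤m = subst (h ≤_) (trans (length-reverse (take m xs)) (length-take-≤ m xs m≤len)) h≤len
        q = suc m ∸ h
        h+q≡ : h + q ≡ suc m
        h+q≡ = m+[n∸m]≡n (m≤n⇒m≤1+n h≤m)
        1≤q : 1 ≤ q
        1≤q = subst (1 ≤_) (sym (+-∸-assoc 1 h≤m)) (s≤s z≤n)
        q≤s : q ≤ s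
        q≤s = +-cancelˡ-≤ h q s (subst (_≤ h + s) (sym h+q≡)
                (≤-trans (s≤s (≤-reflexive (sym (m∸n+n≡m s≤m)))) (+-monoˡ-≤ s m∸s<h)))
        part≡ : part (reverse (take m xs)) h ≡ part xs q
        part≡ = part-reverse-take xs m m≤len (≤-trans q≤s s≤m) h+q≡

m≤n∸o⇒o+m≤n : ∀ {m n} o → 1 ≤ m → m ≤ n ∸ o → o + m ≤ n
m≤n∸o⇒o+m≤n {m} {n} o 1≤m m≤n∸o =
  subst (_≤ n) (+-comm m o) (m≤o∸n⇒m+n≤o m (<⇒≤ (m∸n≢0⇒n<m n∸o≢0)) m≤n∸o)
  where
    n∸o≢0 : ¬ (n ∸ o ≡ 0)
    n∸o≢0 eq = <⇒≱ 1≤m (subst (m ≤_) eq m≤n∸o)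

m∸n<o⇒m∸o<n : ∀ m {n} o → 1 ≤ n → m ∸ n < o → m ∸ o < n
m∸n<o⇒m∸o<n m {suc n} o _ m∸n<o =
  m<n+o⇒m∸n<o m o (subst (m <_) (+-comm (suc n) o) (≤-<-trans (m≤n+m∸n m (suc n)) (+-monoʳ-< (suc n) m∸n<o)))

cAt-rect : ∀ r i j → j ≤ r ∸ i → ∀ μ → cAt r i j μ ≡ durfee 1 μ
cAt-rect r i j j≤r∸i μ with j ≤ᵇ (r ∸ i) in eq
... | true  = refl
... | false = ⊥-elim (subst T eq (≤⇒≤ᵇ j≤r∸i))

cAt-square : ∀ r i j → r ∸ i < j → ∀ μ → cAt r i j μ ≡ durfee 0 μ
cAt-square r i j r∸i<j μ with j ≤ᵇ (r ∸ i) in eq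
... | true  = ⊥-elim (<⇒≱ r∸i<j (≤ᵇ⇒≤ j (r ∸ i) (subst T (sym eq) _)))
... | false = refl

idx-suc : ∀ k → idx (suc k) ≡ idx k ++ [ suc k ]
idx-suc k = trans (cong (map suc) (sym (applyUpTo-∷ʳ (λ x → x) k))) (map-++ suc (upTo k) [ k ])

length-map-idx : ∀ (h : ℕ → ℕ) k → length (map h (idx k)) ≡ k
length-map-idx h k = trans (length-map h (idx k)) (trans (length-map suc (upTo k)) (length-applyUpTo (λ x → x) k))

part-map-idx-last : ∀ (h : ℕ → ℕ) {k} → 1 ≤ k → part (map h (idx k)) k ≡ h k
part-map-idx-last h {suc k} _ = begin
    part (map h (idx (suc k))) (suc k)                  ≡⟨ cong₂ part map≡ (cong suc (sym len)) ⟩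
    part (map h (idx k) ++ [ h (suc k) ]) (suc (length (map h (idx k)) + 0))
                                                        ≡⟨ part-++ʳ (map h (idx k)) [ h (suc k) ] 0 ⟩
    h (suc k)                                           ∎
  where
    open ≡-Reasoning
    map≡ : map h (idx (suc k)) ≡ map h (idx k) ++ [ h (suc k) ]
    map≡ = trans (cong (map h) (idx-suc k)) (map-++ h (idx k) [ suc k ])
    len : length (map h (idx k)) + 0 ≡ k
    len = trans (+-identityʳ _) (length-map-idx h k)

module Blocks (n : ℕ → ℕ → ℕ) (f : ℕ → ℕ) where

  block : ℕ → List ℕ
  block j = map (n j) (idx (f j))

  blocks : ℕ → List ℕ
  blocks k = concatMap block (idx k)

  blocksLength : ℕ → ℕ
  blocksLength zero    = 0
  blocksLength (suc k) = blocksLength k + f (suc k)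

  blocks-suc : ∀ k → blocks (suc k) ≡ blocks k ++ block (suc k)
  blocks-suc k = trans (cong (concatMap block) (idx-suc k))
    (trans (concatMap-++ block (idx k) [ suc k ]) (cong (blocks k ++_) (++-identityʳ (block (suc k)))))

  length-blocks : ∀ k → length (blocks k) ≡ blocksLength k
  length-blocks zero    = refl
  length-blocks (suc k) = trans (cong length (blocks-suc k))
    (trans (length-++ (blocks k)) (cong₂ _+_ (length-blocks k) (length-map-idx (n (suc k)) (f (suc k)))))

  blocks-prefix : ∀ k K → k ≤ K → ∃[ ys ] blocks K ≡ blocks k ++ ys
  blocks-prefix k zero    z≤n = [] , refl
  blocks-prefix k (suc K) k≤K with m≤n⇒m<n∨m≡n k≤K
  ... | inj₂ refl = [] , sym (++-identityʳ (blocks k))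
  ... | inj₁ k<K with blocks-prefix k K (≤-pred k<K)
  ...   | ys , eq = ys ++ block (suc K) ,
          trans (blocks-suc K) (trans (cong (_++ block (suc K)) eq) (++-assoc (blocks k) ys (block (suc K))))

  part-blocks-last : ∀ κ → 1 ≤ f (suc κ) → part (blocks (suc κ)) (blocksLength (suc κ)) ≡ n (suc κ) (f (suc κ))
  part-blocks-last κ 1≤f = begin
      part (blocks (suc κ)) (blocksLength κ + f (suc κ))          ≡⟨ cong₂ part (blocks-suc κ) index≡ ⟩
      part (blocks κ ++ block (suc κ)) (suc (length (blocks κ) + φ)) ≡⟨ part-++ʳ (blocks κ) (block (suc κ)) φ ⟩
      part (block (suc κ)) (suc φ)                                 ≡⟨ cong (part (block (suc κ))) f≡ ⟩
      part (block (suc κ)) (f (suc κ))                             ≡⟨ part-map-idx-last (n (suc κ)) 1≤f ⟩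
      n (suc κ) (f (suc κ))                                        ∎
    where
      open ≡-Reasoning
      φ = f (suc κ) ∸ 1
      f≡ : suc φ ≡ f (suc κ)
      f≡ = m+[n∸m]≡n 1≤f
      index≡ : blocksLength κ + f (suc κ) ≡ suc (length (blocks κ) + φ)
      index≡ = trans (cong₂ _+_ (sym (length-blocks κ)) (sym f≡)) (+-suc (length (blocks κ)) φ)

module Dissection (R i : ℕ) (n : ℕ → ℕ → ℕ) (f : ℕ → ℕ) (ℓ : ℕ)
  (i≤r : i ≤ suc R)
  (f-one : f 1 ≡ 1)
  (f-square : ∀ j → 2 ≤ j → j ≤ i → f j ≡ n (j ∸ 1) (f (j ∸ 1)))
  (f-rect : ∀ j → suc i ≤ j → j ≤ suc R → f j ≡ n (j ∸ 1) (f (j ∸ 1)) ∸ 1)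
  (f-pos : ∀ j → 1 ≤ j → j ≤ R → 1 ≤ f j)
  (ℓ<f : ℓ < f (suc R))
  (sorted : Linked _≤_ (indexSeq (suc R) n f ℓ)) where

  open Blocks n f

  r : ℕ
  r = suc R

  L : List ℕ
  L = indexSeq r n f ℓ

  parts : List ℕ
  parts = partitionOf r n f ℓ

  length-L : length L ≡ blocksLength R + ℓ
  length-L = trans (length-++ (blocks R)) (cong₂ _+_ (length-blocks R) (length-map-idx (n r) ℓ))

  part-L-blockLast : ∀ κ → suc κ ≤ R → part L (blocksLength (suc κ)) ≡ n (suc κ) (f (suc κ))
  part-L-blockLast κ κ<R with blocks-prefix (suc κ) R κ<R
  ... | ys , eq = begin
      part (blocks R ++ tail) a                  ≡⟨ cong (λ zs → part (zs ++ tail) a) eq ⟩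
      part ((blocks (suc κ) ++ ys) ++ tail) a    ≡⟨ cong (λ zs → part zs a) (++-assoc (blocks (suc κ)) ys tail) ⟩
      part (blocks (suc κ) ++ ys ++ tail) a      ≡⟨ part-++ˡ (blocks (suc κ)) (ys ++ tail) (≤-reflexive (sym (length-blocks (suc κ)))) ⟩
      part (blocks (suc κ)) a                    ≡⟨ part-blocks-last κ (f-pos (suc κ) (s≤s z≤n) κ<R) ⟩
      n (suc κ) (f (suc κ))                      ∎
    where
      open ≡-Reasoning
      a = blocksLength (suc κ)
      tail = map (n r) (idx ℓ)

  part-L-≤-blockLast : ∀ κ q → suc κ ≤ R → q ≤ blocksLength (suc κ) → part L q ≤ n (suc κ) (f (suc κ))
  part-L-≤-blockLast κ q κ<R q≤a with blocks-prefix (suc κ) R κ<R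
  ... | ys , eq = subst (part L q ≤_) (part-L-blockLast κ κ<R) (part-mono sorted q≤a a≤length)
    where
      a≤length : blocksLength (suc κ) ≤ length L
      a≤length = begin
        blocksLength (suc κ)                   ≡⟨ length-blocks (suc κ) ⟨
        length (blocks (suc κ))                ≤⟨ m≤m+n _ (length ys) ⟩
        length (blocks (suc κ)) + length ys    ≡⟨ length-++ (blocks (suc κ)) ⟨
        length (blocks (suc κ) ++ ys)          ≡⟨ cong length eq ⟨
        length (blocks R)                      ≤⟨ m≤m+n _ (length (map (n r) (idx ℓ))) ⟩
        length (blocks R) + length (map (n r) (idx ℓ)) ≡⟨ length-++ (blocks R) ⟨
        length L                               ∎
        where open ≤-Reasoning

  record Stage (j k : ℕ) : Set where
    field
      m         : ℕ
      remainder : durfeeμ r i parts j ≡ reverse (take m L)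
      m≤length  : m ≤ length L
      lower     : blocksLength k ≤ m
      upper     : m < blocksLength (suc k)

  peel : ∀ o j κ → suc κ ≤ R →
         (∀ μ → cAt r i (suc j) μ ≡ durfee o μ) →
         f (suc (suc κ)) ≡ n (suc κ) (f (suc κ)) ∸ o →
         (∀ q → 1 ≤ q → q ≤ blocksLength κ → part L q ≤ o + f (suc κ)) →
         Stage j (suc κ) → Stage (suc j) κ × 1 ≤ durfeeC r i parts (suc j)
  peel o j κ κ<R cAt≡ f-next ceiling st = stage′ , positive
    where
      open Stage st
      μ = reverse (take m L)
      c = durfee o μ
      a = blocksLength (suc κ)
      1≤a : 1 ≤ a
      1≤a = ≤-trans (f-pos (suc κ) (s≤s z≤n) κ<R) (m≤n+m (f (suc κ)) (blocksLength κ))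
      m∸a<f : m ∸ a < f (suc (suc κ))
      m∸a<f = +-cancelˡ-< a (m ∸ a) _ (subst (_< a + _) (sym (m+[n∸m]≡n lower)) upper)
      c-lower : suc (m ∸ a) ≤ c
      c-lower = ≤-durfee-reverse-take o L m a m≤length 1≤a lower
        (subst (o + suc (m ∸ a) ≤_) (sym (part-L-blockLast κ κ<R))
          (m≤n∸o⇒o+m≤n o (s≤s z≤n) (subst (suc (m ∸ a) ≤_) f-next m∸a<f)))
      s≤m : blocksLength κ ≤ m
      s≤m = ≤-trans (m≤m+n (blocksLength κ) (f (suc κ))) lower
      f≤m∸s : f (suc κ) ≤ m ∸ blocksLength κ
      f≤m∸s = +-cancelˡ-≤ (blocksLength κ) _ _ (subst (a ≤_) (sym (m+[n∸m]≡n s≤m)) lower)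
      c-upper : c ≤ m ∸ blocksLength κ
      c-upper = durfee-reverse-take-≤ o L m (blocksLength κ) m≤length s≤m
        (λ q 1≤q q≤s → ≤-trans (ceiling q 1≤q q≤s) (+-monoʳ-≤ o f≤m∸s))
      c≤m : c ≤ m
      c≤m = ≤-trans c-upper (m∸n≤m m (blocksLength κ))
      remainder′ : durfeeμ r i parts (suc j) ≡ reverse (take (m ∸ c) L)
      remainder′ = begin
          drop (cAt r i (suc j) (durfeeμ r i parts j)) (durfeeμ r i parts j)
                                           ≡⟨ cong (λ ν → drop (cAt r i (suc j) ν) ν) remainder ⟩
          drop (cAt r i (suc j) μ) μ       ≡⟨ cong (λ k → drop k μ) (cAt≡ μ) ⟩
          drop c μ                         ≡⟨ drop-reverse-take L m c m≤length c≤m ⟩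
          reverse (take (m ∸ c) L)         ∎
        where open ≡-Reasoning
      stage′ : Stage (suc j) κ
      stage′ = record
        { m         = m ∸ c
        ; remainder = remainder′
        ; m≤length  = ≤-trans (m∸n≤m m c) m≤length
        ; lower     = subst (_≤ m ∸ c) (m∸[m∸n]≡n s≤m) (∸-monoʳ-≤ m c-upper)
        ; upper     = m∸n<o⇒m∸o<n m c 1≤a c-lower
        }
      positive : 1 ≤ durfeeC r i parts (suc j)
      positive = subst (1 ≤_) (sym (trans (cong (cAt r i (suc j)) remainder) (cAt≡ μ)))
                       (≤-trans (s≤s z≤n) c-lower)

  rect-ceiling : ∀ κ → suc κ ≤ R → ∀ q → 1 ≤ q → q ≤ blocksLength κ → part L q ≤ 1 + f (suc κ)
  rect-ceiling zero    _   (suc q) _ ()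
  rect-ceiling (suc κ) κ<R q       _ q≤s = ≤-trans (part-L-≤-blockLast κ q (<⇒≤ κ<R) q≤s) last≤
    where
      last≤ : n (suc κ) (f (suc κ)) ≤ 1 + f (suc (suc κ))
      last≤ with suc (suc κ) ≤? i
      ... | yes κ+2≤i = subst (λ x → n (suc κ) (f (suc κ)) ≤ 1 + x)
                          (sym (f-square (suc (suc κ)) (s≤s (s≤s z≤n)) κ+2≤i)) (n≤1+n _)
      ... | no  κ+2≰i = subst (λ x → n (suc κ) (f (suc κ)) ≤ 1 + x)
                          (sym (f-rect (suc (suc κ)) (≰⇒> κ+2≰i) (m≤n⇒m≤1+n κ<R))) (m≤n+m∸n _ 1)

  square-ceiling : ∀ κ → suc κ ≤ R → suc κ < i → ∀ q → 1 ≤ q → q ≤ blocksLength κ → part L q ≤ 0 + f (suc κ)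
  square-ceiling zero    _   _     (suc q) _ ()
  square-ceiling (suc κ) κ<R κ+1<i q       _ q≤s =
    subst (part L q ≤_) (sym (f-square (suc (suc κ)) (s≤s (s≤s z≤n)) (<⇒≤ κ+1<i)))
          (part-L-≤-blockLast κ q (<⇒≤ κ<R) q≤s)

  rect-phase : ∀ j κ → j + suc κ ≡ R → i ≤ suc κ → suc j ≤ r ∸ i
  rect-phase j κ eq i≤κ+1 =
    subst (_≤ r ∸ i) (trans (cong (_∸ κ) (trans (sym eq) (+-suc j κ))) (m+n∸n≡m (suc j) κ))
          (∸-monoʳ-≤ r i≤κ+1)

  square-phase : ∀ j κ → j + suc κ ≡ R → suc κ < i → r ∸ i < suc j
  square-phase j κ eq κ+1<i =
    s≤s (subst (r ∸ i ≤_) (trans (cong (_∸ suc κ) (sym eq)) (m+n∸n≡m j (suc κ))) (∸-monoʳ-≤ r κ+1<i))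

  step : ∀ j κ → j + suc κ ≡ R → Stage j (suc κ) → Stage (suc j) κ × 1 ≤ durfeeC r i parts (suc j)
  step j κ eq with i ≤? suc κ
  ... | yes i≤κ+1 = peel 1 j κ κ<R (cAt-rect r i (suc j) (rect-phase j κ eq i≤κ+1))
                      (f-rect (suc (suc κ)) (s≤s i≤κ+1) (s≤s κ<R)) (rect-ceiling κ κ<R)
    where κ<R = subst (suc κ ≤_) eq (m≤n+m (suc κ) j)
  ... | no  i≰κ+1 = peel 0 j κ κ<R (cAt-square r i (suc j) (square-phase j κ eq (≰⇒> i≰κ+1)))
                      (f-square (suc (suc κ)) (s≤s (s≤s z≤n)) (≰⇒> i≰κ+1)) (square-ceiling κ κ<R (≰⇒> i≰κ+1))
    where κ<R = subst (suc κ ≤_) eq (m≤n+m (suc κ) j)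

  initial : Stage 0 R
  initial = record
    { m         = length L
    ; remainder = cong reverse (sym (take-all (length L) L ≤-refl))
    ; m≤length  = ≤-refl
    ; lower     = subst (blocksLength R ≤_) (sym length-L) (m≤m+n (blocksLength R) ℓ)
    ; upper     = subst (_< blocksLength (suc R)) (sym length-L) (+-monoʳ-< (blocksLength R) ℓ<f)
    }

  stage : ∀ j k → j + k ≡ R → Stage j k
  stage zero    .R refl = initial
  stage (suc j) k eq    = proj₁ (step j k eq′ (stage j (suc k) eq′))
    where eq′ = trans (+-suc j k) eq

  remainder-empty : InD r i parts
  remainder-empty = trans remainder (cong (λ k → reverse (take k L)) m≡0)
    where
      open Stage (stage R 0 (+-identityʳ R))
      m≡0 : m ≡ 0
      m≡0 = n≤0⇒n≡0 (≤-pred (subst (m <_) f-one upper))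

  pieces-nonempty : ∀ j → 1 ≤ j → j ≤ R → 1 ≤ durfeeC r i parts j
  pieces-nonempty (suc j) _ j<R = proj₂ (step j κ eq (stage j (suc κ) eq))
    where
      κ = R ∸ suc j
      eq : j + suc κ ≡ R
      eq = trans (+-suc j κ) (m+[n∸m]≡n j<R)

proposition4p3 : (r i : ℕ) → 2 ≤ r → 1 ≤ i → i ≤ r →
    (n : ℕ → ℕ → ℕ) (f : ℕ → ℕ) (ℓ : ℕ) →
    f 1 ≡ 1 →
    (∀ j → 2 ≤ j → j ≤ i → f j ≡ n (j ∸ 1) (f (j ∸ 1))) →
    (∀ j → suc i ≤ j → j ≤ r → f j ≡ n (j ∸ 1) (f (j ∸ 1)) ∸ 1) →
    (∀ j → 1 ≤ j → j ≤ r ∸ 1 → 1 ≤ f j) →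
    ℓ < f r →
    All (λ m → 1 ≤ m) (indexSeq r n f ℓ) →
    Linked _≤_ (indexSeq r n f ℓ) →
    InD r i (partitionOf r n f ℓ)
      × (∀ j → 1 ≤ j → j ≤ r ∸ 1 → 1 ≤ durfeeC r i (partitionOf r n f ℓ) j)
proposition4p3 (suc R) i _ _ i≤r n f ℓ f-one f-square f-rect f-pos ℓ<f _ sorted =
  remainder-empty , pieces-nonempty
  where open Dissection R i n f ℓ i≤r f-one f-square f-rect f-pos ℓ<f sorted
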